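{- For every integer $n \ge 2$, there exists an $(n-1)$-quasi-perfect code in the Cartesian product $P_n \square P_n \square P_3$ and in the Cartesian product $P_n \square P_n \square P_4$.
   Context: All graphs are simple and connected; $d(x,y)$ is the shortest-path distance. $P_n$ is the path on $n$ vertices. The Cartesian product $G\square H$ has vertex set $V(G)\times V(H)$, with $(g_1,h_1)$ adjacent to $(g_2,h_2)$ iff either $h_1=h_2$ and $g_1g_2\in E(G)$, or $g_1=g_2$ and $h_1h_2\in E(H)$. A code is a subset $D$ of the vertex set. $D$ is $t$-error-correcting if any two distinct codewords are at distance at least $2t+1$. The covering radius of $D$ is the smallest $r$ such that every vertex is at distance at most $r$ from some codeword. $D$ is $t$-quasi-perfect if it is $t$-error-correcting with covering radius $t+1$. -}

module Defs where

open import Data.Nat using (ℕ; zero; suc; _+_; _*_; _≤_; _<_)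
open import Data.Fin using (Fin; toℕ)
open import Data.Product using (Σ; ∃; _×_; _,_)
open import Data.Sum using (_⊎_)
open import Relation.Nullary using (¬_)
open import Relation.Binary.PropositionalEquality using (_≡_)
open import Level using (0ℓ)

record Graph : Set₁ where
  field
    V   : Set
    Adj : V → V → Set

open Graph public

P : ℕ → Graph
P n = record { V = Fin n ; Adj = λ i j → (suc (toℕ i) ≡ toℕ j) ⊎ (suc (toℕ j) ≡ toℕ i) }

_□_ : Graph → Graph → Graph
G □ H = record
  { V = V G × V H
  ; Adj = λ { (g₁ , h₁) (g₂ , h₂) →
             (h₁ ≡ h₂ × Adj G g₁ g₂) ⊎ (g₁ ≡ g₂ × Adj H h₁ h₂) } }

infixr 6 _□_

data Walk (G : Graph) : V G → V G → ℕ → Set where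
  here : ∀ {x} → Walk G x x zero
  step : ∀ {x y z k} → Adj G x y → Walk G y z k → Walk G x z (suc k)

DistLe : (G : Graph) → V G → V G → ℕ → Set
DistLe G x y r = ∃ λ k → k ≤ r × Walk G x y k

Code : Graph → Set₁
Code G = V G → Set

-- t-error-correcting: distinct codewords are at distance ≥ 2t+1,
-- i.e. not at distance ≤ 2t.
ErrorCorrecting : (G : Graph) → ℕ → Code G → Set
ErrorCorrecting G t D =
  ∀ x y → D x → D y → ¬ (x ≡ y) → ¬ DistLe G x y (2 * t)

Covers : (G : Graph) → Code G → ℕ → Set
Covers G D r = ∀ v → ∃ λ c → D c × DistLe G v c r

CoveringRadius : (G : Graph) → Code G → ℕ → Set
CoveringRadius G D r = Covers G D r × (∀ r' → r' < r → ¬ Covers G D r')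

QuasiPerfect : (G : Graph) → ℕ → Code G → Set
QuasiPerfect G t D = ErrorCorrecting G t D × CoveringRadius G D (suc t)

-- Take as code the two opposite corners of the box. The coordinate sum h changes by at most 1
-- along an edge, and every vertex v lies on a geodesic between the corners, at distance h v from
-- one and D ∸ h v from the other, where D = 2(n-1) + q, q ∈ {2,3}, is the diameter. Hence the
-- corners are at distance D > 2(n-1); every vertex is within n of a corner since D ≤ 2n + 1; and
-- a vertex of height n, which exists because h takes every value along a geodesic, is at distance
-- at least n from both corners since D ≥ 2n.
module Submission where

open import Defs
open import Data.Nat using (ℕ; zero; suc; _+_; _*_; _∸_; _≤_; _<_; z≤n; s≤s; ∣_-_∣; _≤?_; _≟_)
open import Data.Nat.Properties
open import Data.Nat.Tactic.RingSolver using (solve-∀)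
open import Data.Fin using (Fin; toℕ; fromℕ; fromℕ<) renaming (zero to fzero)
open import Data.Fin.Properties using (toℕ-injective; toℕ<n; toℕ≤pred[n]; toℕ-fromℕ; toℕ-fromℕ<)
open import Data.Product using (Σ; ∃; _×_; _,_; proj₁; proj₂)
open import Data.Sum using (_⊎_; inj₁; inj₂)
open import Relation.Nullary using (¬_; yes; no)
open import Relation.Binary.PropositionalEquality using (_≡_; refl; sym; trans; cong; cong₂; subst)

private
  variable
    G H : Graph
    k l : ℕ

_++ʷ_ : ∀ {x y z} → Walk G x y k → Walk G y z l → Walk G x z (k + l)
here       ++ʷ w = w
step a v ++ʷ w = step a (v ++ʷ w)

Walk-□ˡ : ∀ {x y h} → Walk G x y k → Walk (G □ H) (x , h) (y , h) k
Walk-□ˡ here       = here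
Walk-□ˡ (step a w) = step (inj₁ (refl , a)) (Walk-□ˡ w)

Walk-□ʳ : ∀ {g x y} → Walk H x y k → Walk (G □ H) (g , x) (g , y) k
Walk-□ʳ here       = here
Walk-□ʳ (step a w) = step (inj₂ (refl , a)) (Walk-□ʳ w)

P-ascend : ∀ {n} k (i j : Fin n) → toℕ i + k ≡ toℕ j → Walk (P n) i j k
P-ascend zero i j e with toℕ-injective (trans (sym (+-identityʳ (toℕ i))) e)
... | refl = here
P-ascend {n} (suc k) i j e = step (inj₁ (sym (toℕ-fromℕ< i+1<n))) (P-ascend k _ j i′+k≡j)
  where
  i+1+k≡j : suc (toℕ i) + k ≡ toℕ j
  i+1+k≡j = trans (sym (+-suc (toℕ i) k)) e
  i+1<n : suc (toℕ i) < n
  i+1<n = ≤-<-trans (≤-trans (m≤m+n (suc (toℕ i)) k) (≤-reflexive i+1+k≡j)) (toℕ<n j)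
  i′+k≡j : toℕ (fromℕ< i+1<n) + k ≡ toℕ j
  i′+k≡j = trans (cong (_+ k) (toℕ-fromℕ< i+1<n)) i+1+k≡j

P-descend : ∀ {n} k (i j : Fin n) → toℕ j + k ≡ toℕ i → Walk (P n) i j k
P-descend zero i j e with toℕ-injective (trans (sym (+-identityʳ (toℕ j))) e)
... | refl = here
P-descend {n} (suc k) i j e = step (inj₂ i′+1≡i) (P-descend k _ j (sym (toℕ-fromℕ< j+k<n)))
  where
  j+k+1≡i : suc (toℕ j + k) ≡ toℕ i
  j+k+1≡i = trans (sym (+-suc (toℕ j) k)) e
  j+k<n : toℕ j + k < n
  j+k<n = ≤-trans (≤-reflexive j+k+1≡i) (<⇒≤ (toℕ<n i))
  i′+1≡i : suc (toℕ (fromℕ< j+k<n)) ≡ toℕ i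
  i′+1≡i = trans (cong suc (toℕ-fromℕ< j+k<n)) j+k+1≡i

Lipschitz : (G : Graph) → (V G → ℕ) → Set
Lipschitz G h = ∀ x y → Adj G x y → ∣ h x - h y ∣ ≤ 1

toℕ-Lipschitz : ∀ n → Lipschitz (P n) toℕ
toℕ-Lipschitz n i j (inj₁ i+1≡j) rewrite sym i+1≡j = ≤-reflexive (∣n-1+n∣≡1 (toℕ i))
  where
  ∣n-1+n∣≡1 : ∀ m → ∣ m - suc m ∣ ≡ 1
  ∣n-1+n∣≡1 zero    = refl
  ∣n-1+n∣≡1 (suc m) = ∣n-1+n∣≡1 m
toℕ-Lipschitz n i j (inj₂ j+1≡i) rewrite ∣-∣-comm (toℕ i) (toℕ j) =
  toℕ-Lipschitz n j i (inj₁ j+1≡i)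

□-Lipschitz : ∀ f g → Lipschitz G f → Lipschitz H g →
              Lipschitz (G □ H) (λ v → f (proj₁ v) + g (proj₂ v))
□-Lipschitz f g f-Lip g-Lip (x , y) (x′ , .y) (inj₁ (refl , a))
  rewrite +-comm (f x) (g y) | +-comm (f x′) (g y) | ∣m+n-m+o∣≡∣n-o∣ (g y) (f x) (f x′) = f-Lip x x′ a
□-Lipschitz f g f-Lip g-Lip (x , y) (.x , y′) (inj₂ (refl , a))
  rewrite ∣m+n-m+o∣≡∣n-o∣ (f x) (g y) (g y′) = g-Lip y y′ a

Walk-Lipschitz : ∀ h {x y} → Lipschitz G h → Walk G x y k → ∣ h x - h y ∣ ≤ k
Walk-Lipschitz h {x} h-Lip here = ≤-reflexive (∣n-n∣≡0 (h x))
Walk-Lipschitz h h-Lip (step {x} {y} {z} {k} a w) = begin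
  ∣ h x - h z ∣                 ≤⟨ ∣-∣-triangle (h x) (h y) (h z) ⟩
  ∣ h x - h y ∣ + ∣ h y - h z ∣ ≤⟨ +-mono-≤ (h-Lip x y a) (Walk-Lipschitz h h-Lip w) ⟩
  1 + k                         ∎
  where open ≤-Reasoning

Walk-intermediate : ∀ h {x y} s → Lipschitz G h → Walk G x y k →
                    h x ≤ s → s ≤ h y → ∃ λ v → h v ≡ s
Walk-intermediate h s h-Lip here hx≤s s≤hy = _ , ≤-antisym hx≤s s≤hy
Walk-intermediate h {x} s h-Lip (step {y = y} a w) hx≤s s≤hz with h x ≟ s
... | yes hx≡s = x , hx≡s
... | no  hx≢s = Walk-intermediate h s h-Lip w hy≤s s≤hz
  where
  hy≤s : h y ≤ s
  hy≤s = begin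
    h y                 ≤⟨ m≤n+∣m-n∣ (h y) (h x) ⟩
    h x + ∣ h y - h x ∣ ≤⟨ +-monoʳ-≤ (h x) (≤-trans (≤-reflexive (∣-∣-comm (h y) (h x))) (h-Lip x y a)) ⟩
    h x + 1             ≡⟨ +-comm (h x) 1 ⟩
    suc (h x)           ≤⟨ ≤∧≢⇒< hx≤s hx≢s ⟩
    s                   ∎
    where open ≤-Reasoning

record Bipolar (G : Graph) : Set where
  field
    bottom top       : V G
    diameter         : ℕ
    height depth     : V G → ℕ
    height-Lipschitz : Lipschitz G height
    height-bottom    : height bottom ≡ 0
    height-top       : height top ≡ diameter
    height+depth     : ∀ v → height v + depth v ≡ diameter
    descend          : ∀ v → Walk G v bottom (height v)
    ascend           : ∀ v → Walk G v top (depth v)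

  poles : Code G
  poles v = v ≡ bottom ⊎ v ≡ top

P-Bipolar : ∀ a → Bipolar (P (suc a))
P-Bipolar a = record
  { bottom           = fzero
  ; top              = fromℕ a
  ; diameter         = a
  ; height           = toℕ
  ; depth            = λ i → a ∸ toℕ i
  ; height-Lipschitz = toℕ-Lipschitz (suc a)
  ; height-bottom    = refl
  ; height-top       = toℕ-fromℕ a
  ; height+depth     = height+depth
  ; descend          = λ i → P-descend (toℕ i) i fzero refl
  ; ascend           = λ i → P-ascend (a ∸ toℕ i) i (fromℕ a) (trans (height+depth i) (sym (toℕ-fromℕ a)))
  }
  where
  height+depth : ∀ i → toℕ i + (a ∸ toℕ i) ≡ a
  height+depth i = m+[n∸m]≡n (toℕ≤pred[n] i)

□-Bipolar : Bipolar G → Bipolar H → Bipolar (G □ H)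
□-Bipolar {G} {H} BG BH = record
  { bottom           = G.bottom , H.bottom
  ; top              = G.top , H.top
  ; diameter         = G.diameter + H.diameter
  ; height           = λ v → G.height (proj₁ v) + H.height (proj₂ v)
  ; depth            = λ v → G.depth (proj₁ v) + H.depth (proj₂ v)
  ; height-Lipschitz = □-Lipschitz G.height H.height G.height-Lipschitz H.height-Lipschitz
  ; height-bottom    = cong₂ _+_ G.height-bottom H.height-bottom
  ; height-top       = cong₂ _+_ G.height-top H.height-top
  ; height+depth     = λ (x , y) → trans (interchange (G.height x) (H.height y) (G.depth x) (H.depth y))
                                         (cong₂ _+_ (G.height+depth x) (H.height+depth y))
  ; descend          = λ (x , y) → Walk-□ˡ (G.descend x) ++ʷ Walk-□ʳ (H.descend y)
  ; ascend           = λ (x , y) → Walk-□ˡ (G.ascend x) ++ʷ Walk-□ʳ (H.ascend y)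
  }
  where
  module G = Bipolar BG
  module H = Bipolar BH
  interchange : ∀ a b c d → (a + b) + (c + d) ≡ (a + c) + (b + d)
  interchange = solve-∀

module _ (B : Bipolar G) where
  open Bipolar B

  private
    distance-lower-bound : ∀ {x y} → DistLe G x y k → ∣ height x - height y ∣ ≤ k
    distance-lower-bound (j , j≤k , w) = ≤-trans (Walk-Lipschitz height height-Lipschitz w) j≤k

    ∣bottom-top∣≡D : ∣ height bottom - height top ∣ ≡ diameter
    ∣bottom-top∣≡D = cong₂ ∣_-_∣ height-bottom height-top

  poles-errorCorrecting : ∀ t → 2 * t < diameter → ErrorCorrecting G t poles
  poles-errorCorrecting t 2t<D x y (inj₁ refl) (inj₁ refl) x≢y _ = x≢y refl
  poles-errorCorrecting t 2t<D x y (inj₂ refl) (inj₂ refl) x≢y _ = x≢y refl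
  poles-errorCorrecting t 2t<D x y (inj₁ refl) (inj₂ refl) _ d =
    <⇒≱ 2t<D (subst (_≤ 2 * t) ∣bottom-top∣≡D (distance-lower-bound d))
  poles-errorCorrecting t 2t<D x y (inj₂ refl) (inj₁ refl) _ d =
    <⇒≱ 2t<D (subst (_≤ 2 * t) (trans (∣-∣-comm (height top) (height bottom)) ∣bottom-top∣≡D) (distance-lower-bound d))

  poles-covers : ∀ r → diameter ≤ r + suc r → Covers G poles r
  poles-covers r D≤2r+1 v with height v ≤? r
  ... | yes hv≤r = bottom , inj₁ refl , height v , hv≤r , descend v
  ... | no  hv≰r = top , inj₂ refl , depth v , dv≤r , ascend v
    where
    dv≤r : depth v ≤ r
    dv≤r = +-cancelˡ-≤ (suc r) (depth v) r (begin
      suc r + depth v    ≤⟨ +-monoˡ-≤ (depth v) (≰⇒> hv≰r) ⟩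
      height v + depth v ≡⟨ height+depth v ⟩
      diameter           ≤⟨ D≤2r+1 ⟩
      r + suc r          ≡⟨ +-comm r (suc r) ⟩
      suc r + r          ∎)
      where open ≤-Reasoning

  -- A vertex of height r is at distance ≥ r from bottom and ≥ diameter ∸ r ≥ r from top.
  poles-not-covers : ∀ r → r + r ≤ diameter → ∀ r′ → r′ < r → ¬ Covers G poles r′
  poles-not-covers r 2r≤D r′ r′<r covers
    with Walk-intermediate height r height-Lipschitz (ascend bottom)
           (≤-trans (≤-reflexive height-bottom) z≤n) (≤-trans (m+n≤o⇒m≤o r 2r≤D) (≤-reflexive (sym height-top)))
  ... | w , hw≡r with covers w
  ... | _ , inj₁ refl , d = <⇒≱ r′<r (begin
    r                            ≡⟨ sym hw≡r ⟩
    height w                     ≡⟨ ∣-∣-identityʳ (height w) ⟨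
    ∣ height w - 0 ∣             ≡⟨ cong (λ h → ∣ height w - h ∣) height-bottom ⟨
    ∣ height w - height bottom ∣ ≤⟨ distance-lower-bound d ⟩
    r′                           ∎)
    where open ≤-Reasoning
  ... | _ , inj₂ refl , d = <⇒≱ r′<r (begin
    r                         ≤⟨ m+n≤o⇒m≤o∸n r 2r≤D ⟩
    diameter ∸ r              ≡⟨ m≤n⇒∣m-n∣≡n∸m r≤D ⟨
    ∣ r - diameter ∣          ≡⟨ cong₂ ∣_-_∣ hw≡r height-top ⟨
    ∣ height w - height top ∣ ≤⟨ distance-lower-bound d ⟩
    r′                        ∎)
    where
    open ≤-Reasoning
    r≤D : r ≤ diameter
    r≤D = m+n≤o⇒m≤o r 2r≤D

  poles-quasiPerfect : ∀ t → suc t + suc t ≤ diameter → diameter ≤ suc t + suc (suc t) →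
                       QuasiPerfect G t poles
  poles-quasiPerfect t 2t+2≤D D≤2t+3 =
    poles-errorCorrecting t (<-≤-trans 2t<2t+2 2t+2≤D) , poles-covers (suc t) D≤2t+3 , poles-not-covers (suc t) 2t+2≤D
    where
    2t<2t+2 : 2 * t < suc t + suc t
    2t<2t+2 = s≤s (+-monoʳ-≤ t (≤-trans (≤-reflexive (+-identityʳ t)) (n≤1+n t)))

cube-corners-quasiPerfect : ∀ t q → 2 ≤ q → q ≤ 3 →
  Σ (Code (P (suc t) □ P (suc t) □ P (suc q))) (QuasiPerfect (P (suc t) □ P (suc t) □ P (suc q)) t)
cube-corners-quasiPerfect t q 2≤q q≤3 = poles , poles-quasiPerfect B t 2t+2≤D D≤2t+3
  where
  B : Bipolar (P (suc t) □ P (suc t) □ P (suc q))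
  B = □-Bipolar (P-Bipolar t) (□-Bipolar (P-Bipolar t) (P-Bipolar q))
  open Bipolar B using (poles)
  2t+2≤D : suc t + suc t ≤ t + (t + q)
  2t+2≤D = ≤-trans (≤-reflexive (e t)) (+-monoʳ-≤ t (+-monoʳ-≤ t 2≤q))
    where
    e : ∀ t → suc t + suc t ≡ t + (t + 2)
    e = solve-∀
  D≤2t+3 : t + (t + q) ≤ suc t + suc (suc t)
  D≤2t+3 = ≤-trans (+-monoʳ-≤ t (+-monoʳ-≤ t q≤3)) (≤-reflexive (e t))
    where
    e : ∀ t → t + (t + 3) ≡ suc t + suc (suc t)
    e = solve-∀

theorem13 : (n : ℕ) → 2 ≤ n →
    Σ (Code (P n □ P n □ P 3)) (λ D → QuasiPerfect (P n □ P n □ P 3) (n ∸ 1) D)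
    × Σ (Code (P n □ P n □ P 4)) (λ D → QuasiPerfect (P n □ P n □ P 4) (n ∸ 1) D)
theorem13 (suc (suc m)) (s≤s (s≤s z≤n)) =
  cube-corners-quasiPerfect (suc m) 2 ≤-refl (s≤s (s≤s z≤n)) ,
  cube-corners-quasiPerfect (suc m) 3 (s≤s (s≤s z≤n)) ≤-refl
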